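{- Let $p\ge 3$. Then $\mu(S_p^2)=\frac{(p+1)^2}{4}$ if $p$ is odd and $\mu(S_p^2)=\frac{p(p+2)}{4}$ if $p$ is even. Moreover, the number of mutual-visibility sets of $S_p^2$ of cardinality $\mu(S_p^2)$ equals $\binom{p}{(p+1)/2}$ if $p$ is odd and $\binom{p+1}{(p+2)/2}$ if $p$ is even.
   Context: For $p\ge 3$, $n\ge1$, the Sierpiński graph $S_p^n$ has vertex set $\{0,1,\dots,p-1\}^n$ (vertices written as words $i_1\cdots i_n$), and $i_1\cdots i_n$ is adjacent to $j_1\cdots j_n$ iff there is $h\in\{1,\dots,n\}$ with $i_t=j_t$ for all $t<h$, $i_h\ne j_h$, and $i_t=j_h$, $j_t=i_h$ for all $t>h$. For a graph $G$ and $X\subseteq V(G)$, vertices $u,v$ are $X$-visible if some shortest $u,v$-path $P$ satisfies $V(P)\cap X\subseteq\{u,v\}$; $X$ is a mutual-visibility set if any two vertices of $X$ are $X$-visible; $\mu(G)$ is the maximum size of a mutual-visibility set. -}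

module Defs where

open import Data.Nat using (ℕ; zero; suc; _+_; _≤_; _<_)
open import Data.Fin using (Fin; toℕ)
open import Data.Vec using (Vec; []; _∷_; lookup)
open import Data.List using (List; []; _∷_; length; filter; map; concatMap; allFin)
open import Data.Bool using (Bool; true; false; T)
open import Data.Product using (Σ; ∃; _×_; _,_)
open import Data.Sum using (_⊎_)
open import Relation.Nullary using (¬_)
open import Relation.Binary.PropositionalEquality using (_≡_; _≢_)
open import Relation.Nullary.Decidable using (does)
open import Data.List.Relation.Unary.All using (All)
open import Data.List.Relation.Unary.AllPairs using (AllPairs)
open import Data.List.Membership.Propositional using (_∈_)
open import Data.List.Relation.Unary.Any using (Any)

-- Sierpiński graph S_p^n : vertices are words i₁⋯iₙ over {0,…,p-1}

Word : ℕ → ℕ → Set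
Word p n = Vec (Fin p) n

SAdj : (p n : ℕ) → Word p n → Word p n → Set
SAdj p n u v = ∃ λ (h : Fin n) →
  (∀ (t : Fin n) → toℕ t < toℕ h → lookup u t ≡ lookup v t) ×
  (lookup u h ≢ lookup v h) ×
  (∀ (t : Fin n) → toℕ h < toℕ t →
     (lookup u t ≡ lookup v h) × (lookup v t ≡ lookup u h))

allWords : (p n : ℕ) → List (Word p n)
allWords p zero = [] ∷ []
allWords p (suc n) = concatMap (λ i → map (i ∷_) (allWords p n)) (allFin p)

module _ {V : Set} (Adj : V → V → Set) where

  data Walk : V → V → Set where
    here : ∀ {u} → Walk u u
    step : ∀ {u v w} → Adj u v → Walk v w → Walk u w

  len : ∀ {u v} → Walk u v → ℕ
  len here = 0
  len (step _ P) = suc (len P)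

  _∈W_ : ∀ {u v} → V → Walk u v → Set
  x ∈W (here {u}) = x ≡ u
  x ∈W (step {u} _ P) = (x ≡ u) ⊎ (x ∈W P)

  Shortest : ∀ {u v} → Walk u v → Set
  Shortest {u} {v} P = ∀ (Q : Walk u v) → len P ≤ len Q

  Visible : (V → Bool) → V → V → Set
  Visible X u v = Σ (Walk u v) λ P → Shortest P ×
    (∀ x → x ∈W P → X x ≡ true → (x ≡ u) ⊎ (x ≡ v))

  MutualVisibility : (V → Bool) → Set
  MutualVisibility X = ∀ u v → X u ≡ true → X v ≡ true → Visible X u v

card : (p n : ℕ) → (Word p n → Bool) → ℕ
card p n X = length (filter (λ w → X w Data.Bool.≟ true) (allWords p n))

MVS : (p n : ℕ) → (Word p n → Bool) → Set
MVS p n = MutualVisibility (SAdj p n)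

IsMu : (p n m : ℕ) → Set
IsMu p n m = (Σ (Word p n → Bool) λ X → MVS p n X × card p n X ≡ m) ×
             (∀ (X : Word p n → Bool) → MVS p n X → card p n X ≤ m)

NumMVSOfSize : (p n m c : ℕ) → Set
NumMVSOfSize p n m c = Σ (List (Word p n → Bool)) λ L →
  (length L ≡ c) ×
  All (λ X → MVS p n X × card p n X ≡ m) L ×
  AllPairs (λ X Y → ∃ λ w → X w ≢ Y w) L ×
  (∀ (X : Word p n → Bool) → MVS p n X → card p n X ≡ m →
     Any (λ Y → ∀ w → X w ≡ Y w) L)

-- Write the vertex ia of S_p^2 as vertex a of the i-th copy of K_p: its edges are the copy
-- edges ia–ib and the bridges ij–ji.  A geodesic between two copies has to cross a bridge,
-- so the rows R i = {a : ia ∈ X} of a mutual-visibility set X obey two local constraints.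
-- With Z the set of nonempty rows and c = p − |Z|, these put every row inside {k} ∪ Zᶜ for a
-- single k, hence |X| ≤ |Z| (1 + c) = z (p + 1 − z), and for every S the set
-- X_S = {ii : i ∈ S} ∪ {ij : i ∈ S, j ∉ S} is a mutual-visibility set of exactly that size.
-- Maximising over z gives μ.  If moreover c ≥ 1, every nonempty row has at least two
-- elements, which forces k = i and X = X_Z; so the maximum sets are the X_S with
-- |S| = (p + 1)/2 for odd p and |S| ∈ {p/2, p/2 + 1} for even p.

module Submission where

open import Defs
open import Data.Nat using (ℕ; zero; suc; _+_; _*_; _≤_; _<_; z≤n; s≤s; s≤s⁻¹; _/_; _%_; ∣_-_∣)
open import Data.Nat.Properties hiding (_≟_)
open import Data.Nat.Combinatorics using (_C_; nCk+nC[k+1]≡[n+1]C[k+1])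
open import Data.Nat.DivMod using (m≡m%n+[m/n]*n; m*n/n≡m)
open import Data.Nat.Tactic.RingSolver using (solve-∀)
open import Data.Fin using (Fin; zero; suc)
open import Data.Fin.Properties using (_≟_; any?; ¬∀⟶∃¬)
open import Data.Fin.Subset
  using (Subset; inside; outside; _∈_; _∉_; _⊆_; _∪_; _∩_; ∁; ⁅_⁆; ⊥; ∣_∣; Nonempty)
open import Data.Fin.Subset.Properties
  using (_∈?_; nonempty?; Empty-unique; ∉⊥; ∣⊥∣≡0; x∈⁅x⁆; x∈⁅y⁆⇒x≡y; ∣⁅x⁆∣≡1; p⊆q⇒∣p∣≤∣q∣;
         p⊂q⇒∣p∣<∣q∣; ⊆-antisym; x∈p∪q⁺; x∈p∪q⁻; x∈p∩q⁻; x∉p⇒x∈∁p; x∈∁p⇒x∉p; ∣∁p∣≡n∸∣p∣; ∣p∣≤n)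
open import Data.Vec using ([]; _∷_; lookup; tabulate)
open import Data.Vec.Properties
  using (∷-injectiveʳ; lookup-replicate; lookup∘tabulate; tabulate∘lookup; tabulate-cong; lookup⇒[]=; []=⇒lookup)
open import Data.Bool using (Bool; true; false; if_then_else_)
import Data.Bool.Properties as Bool
open import Data.List using (List; []; _∷_; _++_; length; map; filter; concatMap)
import Data.List as List
open import Data.List.Properties using (length-map; length-++; filter-++)
import Data.List.Membership.Propositional as L
open import Data.List.Membership.Propositional.Properties
  using (∈-++⁺ˡ; ∈-++⁺ʳ; ∈-++⁻; ∈-map⁺; ∈-map⁻)
import Data.List.Relation.Unary.All as All
import Data.List.Relation.Unary.All.Properties as All
import Data.List.Relation.Unary.AllPairs as AllPairs
import Data.List.Relation.Unary.AllPairs.Properties as AllPairs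
open import Data.List.Relation.Unary.Any using (Any; here)
import Data.List.Relation.Unary.Any as Any
import Data.List.Relation.Unary.Any.Properties as Any
open import Data.List.Relation.Unary.Unique.Propositional using (Unique)
import Data.List.Relation.Unary.Unique.Propositional.Properties as Unique
open import Data.Product using (Σ; ∃; _×_; _,_; proj₁; proj₂)
open import Data.Sum using (_⊎_; inj₁; inj₂)
open import Function using (_∘_)
open import Relation.Nullary using (¬_; Dec; yes; no; does; contradiction)
open import Relation.Nullary.Decidable using (dec-true; ¬?; _×-dec_)
open import Relation.Binary.PropositionalEquality
open import Algebra.Properties.Monoid.Sum +-0-monoid using (sum-cong-≗; sum-syntax)

∑-mono-≤ : ∀ n {f g : Fin n → ℕ} → (∀ i → f i ≤ g i) → ∑[ i < n ] f i ≤ ∑[ i < n ] g i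
∑-mono-≤ zero    f≤g = z≤n
∑-mono-≤ (suc n) f≤g = +-mono-≤ (f≤g zero) (∑-mono-≤ n (f≤g ∘ suc))

∑-mono-≤-equality : ∀ n {f g : Fin n → ℕ} → (∀ i → f i ≤ g i) →
                    ∑[ i < n ] f i ≡ ∑[ i < n ] g i → ∀ i → f i ≡ g i
∑-mono-≤-equality (suc n) {f} {g} f≤g eq = λ where
    zero    → head≡
    (suc i) → ∑-mono-≤-equality n (f≤g ∘ suc) (+-cancelˡ-≡ (f zero) _ _ (trans eq (cong (_+ _) (sym head≡)))) i
  where
  head≡ : f zero ≡ g zero
  head≡ = ≤-antisym (f≤g zero) (+-cancelʳ-≤ _ (g zero) (f zero)
            (≤-trans (+-monoʳ-≤ (g zero) (∑-mono-≤ n (f≤g ∘ suc))) (≤-reflexive (sym eq))))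

∑-indicator : ∀ {n} (S : Subset n) k → ∑[ i < n ] (if lookup S i then k else 0) ≡ ∣ S ∣ * k
∑-indicator []            k = refl
∑-indicator (inside ∷ S)  k = cong (k +_) (∑-indicator S k)
∑-indicator (outside ∷ S) k = ∑-indicator S k

∣tabulate∣≡∑ : ∀ n (f : Fin n → Bool) → ∣ tabulate f ∣ ≡ ∑[ i < n ] (if f i then 1 else 0)
∣tabulate∣≡∑ zero    f = refl
∣tabulate∣≡∑ (suc n) f with f zero
... | true  = cong suc (∣tabulate∣≡∑ n (f ∘ suc))
... | false = ∣tabulate∣≡∑ n (f ∘ suc)

∈-tabulate⁺ : ∀ {n} {f : Fin n → Bool} {i} → f i ≡ true → i ∈ tabulate f
∈-tabulate⁺ {f = f} {i} fi = lookup⇒[]= i _ (trans (lookup∘tabulate f i) fi)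

∈-tabulate⁻ : ∀ {n} {f : Fin n → Bool} {i} → i ∈ tabulate f → f i ≡ true
∈-tabulate⁻ {f = f} {i} i∈ = trans (sym (lookup∘tabulate f i)) ([]=⇒lookup i∈)

∣p∪q∣+∣p∩q∣≡∣p∣+∣q∣ : ∀ {n} (p q : Subset n) → ∣ p ∪ q ∣ + ∣ p ∩ q ∣ ≡ ∣ p ∣ + ∣ q ∣
∣p∪q∣+∣p∩q∣≡∣p∣+∣q∣ []            []            = refl
∣p∪q∣+∣p∩q∣≡∣p∣+∣q∣ (inside ∷ p)  (inside ∷ q)  =
  cong suc (trans (+-suc _ _) (trans (cong suc (∣p∪q∣+∣p∩q∣≡∣p∣+∣q∣ p q)) (sym (+-suc _ _))))
∣p∪q∣+∣p∩q∣≡∣p∣+∣q∣ (inside ∷ p)  (outside ∷ q) = cong suc (∣p∪q∣+∣p∩q∣≡∣p∣+∣q∣ p q)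
∣p∪q∣+∣p∩q∣≡∣p∣+∣q∣ (outside ∷ p) (inside ∷ q)  =
  trans (cong suc (∣p∪q∣+∣p∩q∣≡∣p∣+∣q∣ p q)) (sym (+-suc _ _))
∣p∪q∣+∣p∩q∣≡∣p∣+∣q∣ (outside ∷ p) (outside ∷ q) = ∣p∪q∣+∣p∩q∣≡∣p∣+∣q∣ p q

∣p∪q∣≤∣p∣+∣q∣ : ∀ {n} (p q : Subset n) → ∣ p ∪ q ∣ ≤ ∣ p ∣ + ∣ q ∣
∣p∪q∣≤∣p∣+∣q∣ p q = ≤-trans (m≤m+n _ _) (≤-reflexive (∣p∪q∣+∣p∩q∣≡∣p∣+∣q∣ p q))

∣p∣+∣∁p∣≡n : ∀ {n} (p : Subset n) → ∣ p ∣ + ∣ ∁ p ∣ ≡ n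
∣p∣+∣∁p∣≡n p = trans (cong (∣ p ∣ +_) (∣∁p∣≡n∸∣p∣ p)) (m+[n∸m]≡n (∣p∣≤n p))

p⊆q∧∣p∣≡∣q∣⇒p≡q : ∀ {n} {p q : Subset n} → p ⊆ q → ∣ p ∣ ≡ ∣ q ∣ → p ≡ q
p⊆q∧∣p∣≡∣q∣⇒p≡q {p = p} {q} p⊆q eq = ⊆-antisym p⊆q q⊆p
  where
  q⊆p : q ⊆ p
  q⊆p {x} x∈q with x ∈? p
  ... | yes x∈p = x∈p
  ... | no  x∉p = contradiction eq (<⇒≢ (p⊂q⇒∣p∣<∣q∣ (p⊆q , x , x∈q , x∉p)))

∣⁅x⁆∪∁p∣≡1+∣∁p∣ : ∀ {n} {x : Fin n} {p : Subset n} → x ∈ p → ∣ ⁅ x ⁆ ∪ ∁ p ∣ ≡ suc ∣ ∁ p ∣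
∣⁅x⁆∪∁p∣≡1+∣∁p∣ {n} {x} {p} x∈p = begin
  ∣ ⁅ x ⁆ ∪ ∁ p ∣                        ≡˘⟨ +-identityʳ _ ⟩
  ∣ ⁅ x ⁆ ∪ ∁ p ∣ + 0                    ≡˘⟨ cong (∣ ⁅ x ⁆ ∪ ∁ p ∣ +_) (trans (cong ∣_∣ disjoint) (∣⊥∣≡0 n)) ⟩
  ∣ ⁅ x ⁆ ∪ ∁ p ∣ + ∣ ⁅ x ⁆ ∩ ∁ p ∣      ≡⟨ ∣p∪q∣+∣p∩q∣≡∣p∣+∣q∣ ⁅ x ⁆ (∁ p) ⟩
  ∣ ⁅ x ⁆ ∣ + ∣ ∁ p ∣                    ≡⟨ cong (_+ ∣ ∁ p ∣) (∣⁅x⁆∣≡1 x) ⟩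
  suc ∣ ∁ p ∣                            ∎
  where
  open ≡-Reasoning
  disjoint : ⁅ x ⁆ ∩ ∁ p ≡ ⊥
  disjoint = Empty-unique λ (y , y∈) → let y∈⁅x⁆ , y∈∁p = x∈p∩q⁻ ⁅ x ⁆ (∁ p) y∈ in
    x∈∁p⇒x∉p y∈∁p (subst (_∈ p) (sym (x∈⁅y⁆⇒x≡y x y∈⁅x⁆)) x∈p)

⊆⁅x⁆⇒∣p∣≤1 : ∀ {n} {p : Subset n} {x} → p ⊆ ⁅ x ⁆ → ∣ p ∣ ≤ 1
⊆⁅x⁆⇒∣p∣≤1 {x = x} p⊆ = ≤-trans (p⊆q⇒∣p∣≤∣q∣ p⊆) (≤-reflexive (∣⁅x⁆∣≡1 x))

∣p∣≡k⇒∣∁p∣≡l : ∀ {k l} (p : Subset (k + l)) → ∣ p ∣ ≡ k → ∣ ∁ p ∣ ≡ l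
∣p∣≡k⇒∣∁p∣≡l {k} p ∣p∣≡k = +-cancelˡ-≡ k _ _ (trans (cong (_+ ∣ ∁ p ∣) (sym ∣p∣≡k)) (∣p∣+∣∁p∣≡n p))

subsetsOfSize : ∀ n → ℕ → List (Subset n)
subsetsOfSize zero    zero    = [] ∷ []
subsetsOfSize zero    (suc k) = []
subsetsOfSize (suc n) zero    = map (outside ∷_) (subsetsOfSize n zero)
subsetsOfSize (suc n) (suc k) = map (outside ∷_) (subsetsOfSize n (suc k)) ++ map (inside ∷_) (subsetsOfSize n k)

length-subsetsOfSize : ∀ n k → length (subsetsOfSize n k) ≡ n C k
length-subsetsOfSize zero    zero    = refl
length-subsetsOfSize zero    (suc k) = refl
length-subsetsOfSize (suc n) zero    =
  trans (length-map _ (subsetsOfSize n zero)) (length-subsetsOfSize n zero)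
length-subsetsOfSize (suc n) (suc k) = begin
  length (map (outside ∷_) (subsetsOfSize n (suc k)) ++ map (inside ∷_) (subsetsOfSize n k))
    ≡⟨ length-++ (map (outside ∷_) (subsetsOfSize n (suc k))) ⟩
  length (map (outside ∷_) (subsetsOfSize n (suc k))) + length (map (inside ∷_) (subsetsOfSize n k))
    ≡⟨ cong₂ _+_ (length-map _ (subsetsOfSize n (suc k))) (length-map _ (subsetsOfSize n k)) ⟩
  length (subsetsOfSize n (suc k)) + length (subsetsOfSize n k)
    ≡⟨ cong₂ _+_ (length-subsetsOfSize n (suc k)) (length-subsetsOfSize n k) ⟩
  n C suc k + n C k
    ≡⟨ +-comm (n C suc k) (n C k) ⟩
  n C k + n C suc k
    ≡⟨ nCk+nC[k+1]≡[n+1]C[k+1] n k ⟩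
  suc n C suc k ∎
  where open ≡-Reasoning

∈-subsetsOfSize⁺ : ∀ {n} (S : Subset n) → S L.∈ subsetsOfSize n ∣ S ∣
∈-subsetsOfSize⁺ []            = here refl
∈-subsetsOfSize⁺ (inside ∷ S)  = ∈-++⁺ʳ _ (∈-map⁺ (inside ∷_) (∈-subsetsOfSize⁺ S))
∈-subsetsOfSize⁺ {suc n} (outside ∷ S) with ∣ S ∣ | ∈-subsetsOfSize⁺ S
... | zero  | S∈ = ∈-map⁺ (outside ∷_) S∈
... | suc k | S∈ = ∈-++⁺ˡ (∈-map⁺ (outside ∷_) S∈)

∈-subsetsOfSize⁻ : ∀ n k {S : Subset n} → S L.∈ subsetsOfSize n k → ∣ S ∣ ≡ k
∈-subsetsOfSize⁻ zero    zero    (here refl) = refl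
∈-subsetsOfSize⁻ (suc n) zero    S∈ with ∈-map⁻ (outside ∷_) S∈
... | T , T∈ , refl = ∈-subsetsOfSize⁻ n zero T∈
∈-subsetsOfSize⁻ (suc n) (suc k) S∈ with ∈-++⁻ (map (outside ∷_) (subsetsOfSize n (suc k))) S∈
... | inj₁ S∈₀ with ∈-map⁻ (outside ∷_) S∈₀
...   | T , T∈ , refl = ∈-subsetsOfSize⁻ n (suc k) T∈
∈-subsetsOfSize⁻ (suc n) (suc k) S∈ | inj₂ S∈₁ with ∈-map⁻ (inside ∷_) S∈₁
...   | T , T∈ , refl = cong suc (∈-subsetsOfSize⁻ n k T∈)

subsetsOfSize-unique : ∀ n k → Unique (subsetsOfSize n k)
subsetsOfSize-unique zero    zero    = All.[] AllPairs.∷ AllPairs.[]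
subsetsOfSize-unique zero    (suc k) = AllPairs.[]
subsetsOfSize-unique (suc n) zero    = Unique.map⁺ ∷-injectiveʳ (subsetsOfSize-unique n zero)
subsetsOfSize-unique (suc n) (suc k) =
  Unique.++⁺ (Unique.map⁺ ∷-injectiveʳ (subsetsOfSize-unique n (suc k)))
             (Unique.map⁺ ∷-injectiveʳ (subsetsOfSize-unique n k))
             heads-differ
  where
  heads-differ : ∀ {S} → ¬ (S L.∈ map (outside ∷_) (subsetsOfSize n (suc k)) × S L.∈ map (inside ∷_) (subsetsOfSize n k))
  heads-differ (S∈₀ , S∈₁) with ∈-map⁻ (outside ∷_) S∈₀ | ∈-map⁻ (inside ∷_) S∈₁
  ... | _ , _ , refl | _ , _ , ()

subsetOfSize : ∀ {n k} → k ≤ n → Σ (Subset n) λ S → ∣ S ∣ ≡ k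
subsetOfSize {n} {zero} _ = ⊥ , ∣⊥∣≡0 n
subsetOfSize (s≤s k≤n) with subsetOfSize k≤n
... | S , ∣S∣≡k = inside ∷ S , cong suc ∣S∣≡k

module _ {A B : Set} (X : B → Bool) where

  length-filter-map : ∀ (f : A → B) xs →
    length (filter (λ w → X w Bool.≟ true) (map f xs)) ≡ length (filter (λ x → X (f x) Bool.≟ true) xs)
  length-filter-map f []       = refl
  length-filter-map f (x ∷ xs) with X (f x)
  ... | true  = cong suc (length-filter-map f xs)
  ... | false = length-filter-map f xs

  length-filter-concatMap-tabulate : ∀ {m} (F : A → List B) (g : Fin m → A) →
    length (filter (λ w → X w Bool.≟ true) (concatMap F (List.tabulate g))) ≡
    ∑[ i < m ] length (filter (λ w → X w Bool.≟ true) (F (g i)))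
  length-filter-concatMap-tabulate {zero}  F g = refl
  length-filter-concatMap-tabulate {suc m} F g = begin
    length (filter X? (F (g zero) ++ concatMap F (List.tabulate (g ∘ suc))))
      ≡⟨ cong length (filter-++ X? (F (g zero)) _) ⟩
    length (filter X? (F (g zero)) ++ filter X? (concatMap F (List.tabulate (g ∘ suc))))
      ≡⟨ length-++ (filter X? (F (g zero))) ⟩
    length (filter X? (F (g zero))) + length (filter X? (concatMap F (List.tabulate (g ∘ suc))))
      ≡⟨ cong (length (filter X? (F (g zero))) +_) (length-filter-concatMap-tabulate F (g ∘ suc)) ⟩
    ∑[ i < suc m ] length (filter X? (F (g i))) ∎
    where
    open ≡-Reasoning
    X? : (w : B) → Dec (X w ≡ true)
    X? w = X w Bool.≟ true

card-∷ : ∀ p n (X : Word p (suc n) → Bool) → card p (suc n) X ≡ ∑[ i < p ] card p n (λ w → X (i ∷ w))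
card-∷ p n X = trans (length-filter-concatMap-tabulate X (λ i → map (i ∷_) (allWords p n)) (λ i → i))
                     (sum-cong-≗ (λ i → length-filter-map X (i ∷_) (allWords p n)))

card-[] : ∀ p (X : Word p 0 → Bool) → card p 0 X ≡ (if X [] then 1 else 0)
card-[] p X with X []
... | true  = refl
... | false = refl

-- Products with a prescribed sum

4mn+∣m-n∣²≡[m+n]² : ∀ m n → 4 * (m * n) + ∣ m - n ∣ * ∣ m - n ∣ ≡ (m + n) * (m + n)
4mn+∣m-n∣²≡[m+n]² m n with ≤-total m n
... | inj₁ m≤n with m≤n⇒∃[o]m+o≡n m≤n
...   | d , refl rewrite ∣m-m+n∣≡n m d = identity m d
  where
  identity : ∀ m d → 4 * (m * (m + d)) + d * d ≡ (m + (m + d)) * (m + (m + d))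
  identity = solve-∀
4mn+∣m-n∣²≡[m+n]² m n | inj₂ n≤m with m≤n⇒∃[o]m+o≡n n≤m
...   | d , refl rewrite ∣-∣-comm (n + d) n | ∣m-m+n∣≡n n d = identity n d
  where
  identity : ∀ n d → 4 * ((n + d) * n) + d * d ≡ ((n + d) + n) * ((n + d) + n)
  identity = solve-∀

∣m-n∣≡1⇒ : ∀ m n → ∣ m - n ∣ ≡ 1 → suc m ≡ n ⊎ m ≡ suc n
∣m-n∣≡1⇒ zero          (suc zero) _ = inj₁ refl
∣m-n∣≡1⇒ (suc zero)    zero       _ = inj₂ refl
∣m-n∣≡1⇒ (suc (suc m)) zero       ()
∣m-n∣≡1⇒ zero          (suc (suc n)) ()
∣m-n∣≡1⇒ (suc m)       (suc n)    eq with ∣m-n∣≡1⇒ m n eq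
... | inj₁ e = inj₁ (cong suc e)
... | inj₂ e = inj₂ (cong suc e)

m+m≡n+n⇒m≡n : ∀ m n → m + m ≡ n + n → m ≡ n
m+m≡n+n⇒m≡n zero    zero    _  = refl
m+m≡n+n⇒m≡n (suc m) (suc n) eq =
  cong suc (m+m≡n+n⇒m≡n m n (suc-injective (trans (sym (+-suc m m)) (trans (suc-injective eq) (+-suc n n)))))

[k+k]²≡4k² : ∀ k → (k + k) * (k + k) ≡ 4 * (k * k)
[k+k]²≡4k² = solve-∀

[1+2k]²≡4k[1+k]+1 : ∀ k → suc (k + k) * suc (k + k) ≡ 4 * (k * suc k) + 1
[1+2k]²≡4k[1+k]+1 = solve-∀

module _ (m n : ℕ) where

  private
    d : ℕ
    d = ∣ m - n ∣

    4mn+d²≡ : ∀ {s} → m + n ≡ s → 4 * (m * n) + d * d ≡ s * s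
    4mn+d²≡ refl = 4mn+∣m-n∣²≡[m+n]² m n

  m+n≡2k⇒m*n≤k*k : ∀ k → m + n ≡ k + k → m * n ≤ k * k
  m+n≡2k⇒m*n≤k*k k eq = *-cancelˡ-≤ 4 (begin
    4 * (m * n)           ≤⟨ m≤m+n _ (d * d) ⟩
    4 * (m * n) + d * d   ≡⟨ 4mn+d²≡ eq ⟩
    (k + k) * (k + k)     ≡⟨ [k+k]²≡4k² k ⟩
    4 * (k * k)           ∎)
    where open ≤-Reasoning

  m+n≡2k⇒m*n≡k*k⇒m≡k : ∀ k → m + n ≡ k + k → m * n ≡ k * k → m ≡ k
  m+n≡2k⇒m*n≡k*k⇒m≡k k eq mn≡kk = m+m≡n+n⇒m≡n m k (trans (cong (m +_) m≡n) eq)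
    where
    d*d≡0 : d * d ≡ 0
    d*d≡0 = +-cancelˡ-≡ (4 * (k * k)) _ _ (begin
      4 * (k * k) + d * d   ≡˘⟨ cong (λ x → 4 * x + d * d) mn≡kk ⟩
      4 * (m * n) + d * d   ≡⟨ 4mn+d²≡ eq ⟩
      (k + k) * (k + k)     ≡⟨ [k+k]²≡4k² k ⟩
      4 * (k * k)           ≡˘⟨ +-identityʳ _ ⟩
      4 * (k * k) + 0       ∎)
      where open ≡-Reasoning
    m≡n : m ≡ n
    m≡n with m*n≡0⇒m≡0∨n≡0 d d*d≡0
    ... | inj₁ d≡0 = ∣m-n∣≡0⇒m≡n d≡0
    ... | inj₂ d≡0 = ∣m-n∣≡0⇒m≡n d≡0

  m+n≡1+2k⇒m*n≤k*[1+k] : ∀ k → m + n ≡ suc (k + k) → m * n ≤ k * suc k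
  m+n≡1+2k⇒m*n≤k*[1+k] k eq = <⇒≤pred (*-cancelˡ-< 4 (m * n) (suc (k * suc k)) (begin-strict
    4 * (m * n)                 ≤⟨ m≤m+n _ (d * d) ⟩
    4 * (m * n) + d * d         ≡⟨ 4mn+d²≡ eq ⟩
    suc (k + k) * suc (k + k)   ≡⟨ [1+2k]²≡4k[1+k]+1 k ⟩
    4 * (k * suc k) + 1         <⟨ +-monoʳ-< (4 * (k * suc k)) (s≤s (s≤s z≤n)) ⟩
    4 * (k * suc k) + 4         ≡⟨ trans (+-comm _ 4) (sym (*-suc 4 (k * suc k))) ⟩
    4 * suc (k * suc k)         ∎))
    where open ≤-Reasoning

  m+n≡1+2k⇒m*n≡k*[1+k]⇒m≡k⊎m≡1+k : ∀ k → m + n ≡ suc (k + k) → m * n ≡ k * suc k → m ≡ k ⊎ m ≡ suc k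
  m+n≡1+2k⇒m*n≡k*[1+k]⇒m≡k⊎m≡1+k k eq mn≡ with ∣m-n∣≡1⇒ m n (m*n≡1⇒m≡1 d d d*d≡1)
    where
    d*d≡1 : d * d ≡ 1
    d*d≡1 = +-cancelˡ-≡ (4 * (k * suc k)) _ _ (begin
      4 * (k * suc k) + d * d     ≡˘⟨ cong (λ x → 4 * x + d * d) mn≡ ⟩
      4 * (m * n) + d * d         ≡⟨ 4mn+d²≡ eq ⟩
      suc (k + k) * suc (k + k)   ≡⟨ [1+2k]²≡4k[1+k]+1 k ⟩
      4 * (k * suc k) + 1         ∎)
      where open ≡-Reasoning
  ... | inj₁ refl = inj₁ (m+m≡n+n⇒m≡n m k (suc-injective (trans (sym (+-suc m m)) eq)))
  ... | inj₂ refl = inj₂ (cong suc (m+m≡n+n⇒m≡n n k (suc-injective eq)))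

occupied : ∀ {n} → (Fin n → Subset n) → Subset n
occupied R = tabulate (λ i → does (nonempty? (R i)))

module _ {n} {R : Fin n → Subset n} where

  ∈-occupied⁺ : ∀ {i a} → a ∈ R i → i ∈ occupied R
  ∈-occupied⁺ a∈Ri = ∈-tabulate⁺ (dec-true (nonempty? _) (_ , a∈Ri))

  ∈-occupied⁻ : ∀ {i} → i ∈ occupied R → Nonempty (R i)
  ∈-occupied⁻ {i} i∈ with nonempty? (R i) | ∈-tabulate⁻ i∈
  ... | yes ne | _ = ne

  ∉-occupied⇒≡⊥ : ∀ {i} → i ∉ occupied R → R i ≡ ⊥
  ∉-occupied⇒≡⊥ i∉ = Empty-unique (λ (_ , a∈Ri) → i∉ (∈-occupied⁺ a∈Ri))

idealRow : ∀ {n} → Subset n → Fin n → Subset n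
idealRow S i = if lookup S i then ⁅ i ⁆ ∪ ∁ S else ⊥

module _ {n} {S : Subset n} {i : Fin n} where

  idealRow-∈ : i ∈ S → idealRow S i ≡ ⁅ i ⁆ ∪ ∁ S
  idealRow-∈ i∈S rewrite []=⇒lookup i∈S = refl

  idealRow-∉ : i ∉ S → idealRow S i ≡ ⊥
  idealRow-∉ i∉S with lookup S i in e
  ... | true  = contradiction (lookup⇒[]= i S e) i∉S
  ... | false = refl

  ∣idealRow∣-∈ : i ∈ S → ∣ idealRow S i ∣ ≡ suc ∣ ∁ S ∣
  ∣idealRow∣-∈ i∈S = trans (cong ∣_∣ (idealRow-∈ i∈S)) (∣⁅x⁆∪∁p∣≡1+∣∁p∣ i∈S)

  ∣idealRow∣ : ∣ idealRow S i ∣ ≡ (if lookup S i then suc ∣ ∁ S ∣ else 0)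
  ∣idealRow∣ with lookup S i in e
  ... | true  = ∣⁅x⁆∪∁p∣≡1+∣∁p∣ (lookup⇒[]= i S e)
  ... | false = ∣⊥∣≡0 n

∑∣idealRow∣ : ∀ {n} (S : Subset n) → ∑[ i < n ] ∣ idealRow S i ∣ ≡ ∣ S ∣ * suc ∣ ∁ S ∣
∑∣idealRow∣ S = trans (sum-cong-≗ (λ i → ∣idealRow∣ {S = S} {i})) (∑-indicator S _)

module _ {n} {S : Subset n} {i a : Fin n} where

  ∈-idealRow⁻ : a ∈ idealRow S i → i ∈ S × (a ≡ i ⊎ a ∉ S)
  ∈-idealRow⁻ a∈ with i ∈? S
  ... | no  i∉S = contradiction (subst (a ∈_) (idealRow-∉ i∉S) a∈) ∉⊥
  ... | yes i∈S with x∈p∪q⁻ ⁅ i ⁆ (∁ S) (subst (a ∈_) (idealRow-∈ i∈S) a∈)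
  ...   | inj₁ a∈⁅i⁆ = i∈S , inj₁ (x∈⁅y⁆⇒x≡y i a∈⁅i⁆)
  ...   | inj₂ a∈∁S  = i∈S , inj₂ (x∈∁p⇒x∉p a∈∁S)

  ∉-idealRow : a ∈ S → a ≢ i → a ∉ idealRow S i
  ∉-idealRow a∈S a≢i a∈ with ∈-idealRow⁻ a∈
  ... | _ , inj₁ a≡i = a≢i a≡i
  ... | _ , inj₂ a∉S = a∉S a∈S

-- The constraints that mutual visibility imposes on the rows R i = {a : ia ∈ X} of a
-- vertex set X of S_p^2: if ij, jb ∈ X (b ≠ i), the only geodesic ij–ji–jb keeps ji out of
-- X; if ia, jb ∈ X (a ≠ j, b ≠ i), every geodesic passes through ij and ji or, when a = b,
-- through ai and aj.
record VisibilityConstraints {n} (R : Fin n → Subset n) : Set where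
  field
    bridge : ∀ {i j b} → i ≢ j → b ≢ i → j ∈ R i → b ∈ R j → i ∉ R j
    cross  : ∀ {i a j b} → i ≢ j → a ≢ j → b ≢ i → a ∈ R i → b ∈ R j →
             (j ∉ R i × i ∉ R j) ⊎ (a ≡ b × i ∉ R a × j ∉ R a)

module _ {n} {R : Fin n → Subset n} (vc : VisibilityConstraints R) where
  open VisibilityConstraints vc

  private
    Z : Subset n
    Z = occupied R

  occupiedNeighbour⊎row⊆⁅self⁆∪∁occupied : ∀ i →
    (∃ λ j → i ≢ j × j ∈ R i × j ∈ Z) ⊎ R i ⊆ ⁅ i ⁆ ∪ ∁ Z
  occupiedNeighbour⊎row⊆⁅self⁆∪∁occupied i
    with any? (λ j → ¬? (i ≟ j) ×-dec (j ∈? R i) ×-dec (j ∈? Z))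
  ... | yes (j , i≢j , j∈Ri , j∈Z) = inj₁ (j , i≢j , j∈Ri , j∈Z)
  ... | no  none = inj₂ λ {a} a∈Ri → x∈p∪q⁺ (classify a a∈Ri)
    where
    classify : ∀ a → a ∈ R i → a ∈ ⁅ i ⁆ ⊎ a ∈ ∁ Z
    classify a a∈Ri with i ≟ a | a ∈? Z
    ... | yes refl | _      = inj₁ (x∈⁅x⁆ i)
    ... | no  i≢a  | yes a∈Z = contradiction (a , i≢a , a∈Ri , a∈Z) none
    ... | no  _    | no  a∉Z = inj₂ (x∉p⇒x∈∁p a∉Z)

  -- If i ∈ R j, the bridge constraint leaves only j in R i; otherwise the cross constraint
  -- makes every a ≠ j in R i equal to each element of R j, and unoccupied.
  module _ {i j} (i≢j : i ≢ j) (j∈Ri : j ∈ R i) (j∈Z : j ∈ Z) where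

    private
      row⊆⁅j⁆ : i ∈ R j → R i ⊆ ⁅ j ⁆
      row⊆⁅j⁆ i∈Rj {a} a∈Ri with a ≟ j
      ... | yes refl = x∈⁅x⁆ j
      ... | no  a≢j  = contradiction j∈Ri (bridge (i≢j ∘ sym) a≢j i∈Rj a∈Ri)

      forced : i ∉ R j → ∀ {a b} → a ∈ R i → a ≢ j → b ∈ R j → a ≡ b × i ∉ R a × j ∉ R a
      forced i∉Rj {b = b} a∈Ri a≢j b∈Rj with cross i≢j a≢j b≢i a∈Ri b∈Rj
        where
        b≢i : b ≢ i
        b≢i refl = i∉Rj b∈Rj
      ... | inj₁ (j∉Ri , _) = contradiction j∈Ri j∉Ri
      ... | inj₂ r          = r

      unoccupied : i ∉ R j → ∀ {a} → a ∈ R i → a ≢ j → a ∉ Z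
      unoccupied i∉Rj {a} a∈Ri a≢j a∈Z with ∈-occupied⁻ j∈Z | ∈-occupied⁻ a∈Z
      ... | b , b∈Rj | d , d∈Ra with forced i∉Rj a∈Ri a≢j b∈Rj
      ...   | refl , i∉Ra , _ with cross (λ { refl → i∉Rj b∈Rj }) (a≢j ∘ sym) (λ { refl → i∉Ra d∈Ra }) j∈Ri d∈Ra
      ...     | inj₁ (a∉Ri , _)    = a∉Ri a∈Ri
      ...     | inj₂ (_ , _ , a∉Rj) = a∉Rj b∈Rj

    row⊆⁅neighbour⁆∪∁occupied : R i ⊆ ⁅ j ⁆ ∪ ∁ Z
    row⊆⁅neighbour⁆∪∁occupied {a} a∈Ri with a ≟ j | i ∈? R j
    ... | yes refl | _        = x∈p∪q⁺ (inj₁ (x∈⁅x⁆ j))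
    ... | no  a≢j  | yes i∈Rj = contradiction (x∈⁅y⁆⇒x≡y j (row⊆⁅j⁆ i∈Rj a∈Ri)) a≢j
    ... | no  a≢j  | no  i∉Rj = x∈p∪q⁺ (inj₂ (x∉p⇒x∈∁p (unoccupied i∉Rj a∈Ri a≢j)))

    ∣row∣≤1⊎∣neighbourRow∣≤1 : ∣ R i ∣ ≤ 1 ⊎ ∣ R j ∣ ≤ 1
    ∣row∣≤1⊎∣neighbourRow∣≤1 with i ∈? R j
    ... | yes i∈Rj = inj₁ (⊆⁅x⁆⇒∣p∣≤1 (row⊆⁅j⁆ i∈Rj))
    ... | no  i∉Rj with any? (λ a → (a ∈? R i) ×-dec ¬? (a ≟ j))
    ...   | yes (a , a∈Ri , a≢j) = inj₂ (⊆⁅x⁆⇒∣p∣≤1 λ b∈Rj →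
              subst (_∈ ⁅ a ⁆) (proj₁ (forced i∉Rj a∈Ri a≢j b∈Rj)) (x∈⁅x⁆ a))
    ...   | no  none = inj₁ (⊆⁅x⁆⇒∣p∣≤1 λ {a} a∈Ri → only-j a a∈Ri)
      where
      only-j : ∀ a → a ∈ R i → a ∈ ⁅ j ⁆
      only-j a a∈Ri with a ≟ j
      ... | yes refl = x∈⁅x⁆ j
      ... | no  a≢j  = contradiction (a , a∈Ri , a≢j) none

  row⊆⁅hub⁆∪∁occupied : ∀ i → ∃ λ k → R i ⊆ ⁅ k ⁆ ∪ ∁ Z
  row⊆⁅hub⁆∪∁occupied i with occupiedNeighbour⊎row⊆⁅self⁆∪∁occupied i
  ... | inj₁ (j , i≢j , j∈Ri , j∈Z) = j , row⊆⁅neighbour⁆∪∁occupied i≢j j∈Ri j∈Z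
  ... | inj₂ Ri⊆                    = i , Ri⊆

  ∣row∣≤∣idealRow∣ : ∀ i → ∣ R i ∣ ≤ ∣ idealRow Z i ∣
  ∣row∣≤∣idealRow∣ i with i ∈? Z | row⊆⁅hub⁆∪∁occupied i
  ... | no  i∉Z | _ = ≤-trans (≤-reflexive (trans (cong ∣_∣ (∉-occupied⇒≡⊥ i∉Z)) (∣⊥∣≡0 n))) z≤n
  ... | yes i∈Z | k , Ri⊆ = begin
    ∣ R i ∣              ≤⟨ p⊆q⇒∣p∣≤∣q∣ Ri⊆ ⟩
    ∣ ⁅ k ⁆ ∪ ∁ Z ∣      ≤⟨ ∣p∪q∣≤∣p∣+∣q∣ ⁅ k ⁆ (∁ Z) ⟩
    ∣ ⁅ k ⁆ ∣ + ∣ ∁ Z ∣  ≡⟨ cong (_+ ∣ ∁ Z ∣) (∣⁅x⁆∣≡1 k) ⟩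
    suc ∣ ∁ Z ∣          ≡˘⟨ ∣idealRow∣-∈ i∈Z ⟩
    ∣ idealRow Z i ∣     ∎
    where open ≤-Reasoning

  -- An unoccupied index makes every occupied row have at least two elements, which
  -- excludes the case of an occupied neighbour.
  module _ (∣row∣≡ : ∀ i → ∣ R i ∣ ≡ ∣ idealRow Z i ∣) (∣∁Z∣≥1 : 1 ≤ ∣ ∁ Z ∣) where

    private
      occupiedRow≰1 : ∀ {k} → k ∈ Z → ¬ ∣ R k ∣ ≤ 1
      occupiedRow≰1 k∈Z = <⇒≱ (subst (1 <_) (sym (trans (∣row∣≡ _) (∣idealRow∣-∈ k∈Z))) (s≤s ∣∁Z∣≥1))

    row≡idealRow : ∀ i → R i ≡ idealRow Z i
    row≡idealRow i with i ∈? Z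
    ... | no  i∉Z = trans (∉-occupied⇒≡⊥ i∉Z) (sym (idealRow-∉ i∉Z))
    ... | yes i∈Z with occupiedNeighbour⊎row⊆⁅self⁆∪∁occupied i
    ...   | inj₂ Ri⊆ = p⊆q∧∣p∣≡∣q∣⇒p≡q (λ a∈Ri → subst (_ ∈_) (sym (idealRow-∈ i∈Z)) (Ri⊆ a∈Ri)) (∣row∣≡ i)
    ...   | inj₁ (j , i≢j , j∈Ri , j∈Z) with ∣row∣≤1⊎∣neighbourRow∣≤1 i≢j j∈Ri j∈Z
    ...     | inj₁ ∣Ri∣≤1 = contradiction ∣Ri∣≤1 (occupiedRow≰1 i∈Z)
    ...     | inj₂ ∣Rj∣≤1 = contradiction ∣Rj∣≤1 (occupiedRow≰1 j∈Z)

  ∑∣row∣≤∣occupied∣*[1+∣∁occupied∣] : ∑[ i < n ] ∣ R i ∣ ≤ ∣ Z ∣ * suc ∣ ∁ Z ∣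
  ∑∣row∣≤∣occupied∣*[1+∣∁occupied∣] = ≤-trans (∑-mono-≤ n ∣row∣≤∣idealRow∣) (≤-reflexive (∑∣idealRow∣ Z))

  ∑∣row∣≡⇒row≡idealRow : ∑[ i < n ] ∣ R i ∣ ≡ ∣ Z ∣ * suc ∣ ∁ Z ∣ → 1 ≤ ∣ ∁ Z ∣ → ∀ i → R i ≡ idealRow Z i
  ∑∣row∣≡⇒row≡idealRow eq =
    row≡idealRow (∑-mono-≤-equality n ∣row∣≤∣idealRow∣ (trans eq (sym (∑∣idealRow∣ Z))))

-- The Sierpiński graph S_p^2

module _ {V : Set} {Adj : V → V → Set} where

  start∈W : ∀ {u v} (P : Walk Adj u v) → _∈W_ Adj u P
  start∈W here       = refl
  start∈W (step _ P) = inj₁ refl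

  len-lowerBound : (d : V → V → ℕ) → (∀ u → d u u ≡ 0) → (∀ {u w} v → Adj u w → d u v ≤ suc (d w v)) →
                   ∀ {u v} (P : Walk Adj u v) → d u v ≤ len Adj P
  len-lowerBound d d-diag d-step {u} here      = ≤-reflexive (d-diag u)
  len-lowerBound d d-diag d-step (step uw P) = ≤-trans (d-step _ uw) (s≤s (len-lowerBound d d-diag d-step P))

pattern ⟨_,_⟩ i a = i ∷ a ∷ []

module SierpińskiSquare (p : ℕ) where

  Vertex : Set
  Vertex = Word p 2

  Adj : Vertex → Vertex → Set
  Adj = SAdj p 2

  _∈ᵂ_ : ∀ {u v} → Vertex → Walk Adj u v → Set
  x ∈ᵂ P = _∈W_ Adj x P

  adj-cases : ∀ {i a j b} → Adj ⟨ i , a ⟩ ⟨ j , b ⟩ → (i ≡ j × a ≢ b) ⊎ (i ≢ j × a ≡ j × b ≡ i)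
  adj-cases (zero , _ , i≢j , later)          = inj₂ (i≢j , later (suc zero) (s≤s z≤n))
  adj-cases (suc zero , earlier , a≢b , _) = inj₁ (earlier zero (s≤s z≤n) , a≢b)

  adj-inner : ∀ {i a b} → a ≢ b → Adj ⟨ i , a ⟩ ⟨ i , b ⟩
  adj-inner a≢b = suc zero , (λ { zero _ → refl ; (suc zero) (s≤s ()) }) , a≢b , λ { zero () ; (suc zero) (s≤s ()) }

  adj-bridge : ∀ {i j} → i ≢ j → Adj ⟨ i , j ⟩ ⟨ j , i ⟩
  adj-bridge i≢j = zero , (λ _ ()) , i≢j , λ { (suc zero) _ → refl , refl }

  δ : Fin p → Fin p → ℕ
  δ a b = if does (a ≟ b) then 0 else 1

  δ-refl : ∀ a → δ a a ≡ 0
  δ-refl a with a ≟ a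
  ... | yes _   = refl
  ... | no  a≢a = contradiction refl a≢a

  δ-≢ : ∀ {a b} → a ≢ b → δ a b ≡ 1
  δ-≢ {a} {b} a≢b with a ≟ b
  ... | yes a≡b = contradiction a≡b a≢b
  ... | no  _   = refl

  δ≤1 : ∀ a b → δ a b ≤ 1
  δ≤1 a b with does (a ≟ b)
  ... | true  = z≤n
  ... | false = ≤-refl

  δ-sym : ∀ a b → δ a b ≡ δ b a
  δ-sym a b with a ≟ b
  ... | yes refl = sym (δ-refl a)
  ... | no  a≢b  = sym (δ-≢ (a≢b ∘ sym))

  dist : Vertex → Vertex → ℕ
  dist ⟨ i , a ⟩ ⟨ j , b ⟩ = if does (i ≟ j) then δ a b else suc (δ a j + δ b i)

  dist-≡ : ∀ i a b → dist ⟨ i , a ⟩ ⟨ i , b ⟩ ≡ δ a b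
  dist-≡ i a b with i ≟ i
  ... | yes _   = refl
  ... | no  i≢i = contradiction refl i≢i

  dist-≢ : ∀ {i j} a b → i ≢ j → dist ⟨ i , a ⟩ ⟨ j , b ⟩ ≡ suc (δ a j + δ b i)
  dist-≢ {i} {j} a b i≢j with i ≟ j
  ... | yes i≡j = contradiction i≡j i≢j
  ... | no  _   = refl

  dist-≢-≥2 : ∀ {i a j b} → i ≢ j → a ≢ j → 2 ≤ dist ⟨ i , a ⟩ ⟨ j , b ⟩
  dist-≢-≥2 {a = a} {b = b} i≢j a≢j rewrite dist-≢ a b i≢j | δ-≢ a≢j = s≤s (s≤s z≤n)

  dist-≢-≥3 : ∀ {i a j b} → i ≢ j → a ≢ j → b ≢ i → 3 ≤ dist ⟨ i , a ⟩ ⟨ j , b ⟩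
  dist-≢-≥3 {a = a} {b = b} i≢j a≢j b≢i rewrite dist-≢ a b i≢j | δ-≢ a≢j | δ-≢ b≢i = ≤-refl

  dist≤3 : ∀ u v → dist u v ≤ 3
  dist≤3 ⟨ i , a ⟩ ⟨ j , b ⟩ with does (i ≟ j)
  ... | true  = ≤-trans (δ≤1 a b) (s≤s z≤n)
  ... | false = s≤s (+-mono-≤ (δ≤1 a j) (δ≤1 b i))

  dist-diag : ∀ u → dist u u ≡ 0
  dist-diag ⟨ i , a ⟩ = trans (dist-≡ i a a) (δ-refl a)

  dist-step : ∀ {u w} v → Adj u w → dist u v ≤ suc (dist w v)
  dist-step {⟨ i , a ⟩} {⟨ _ , e ⟩} ⟨ j , b ⟩ uw with adj-cases uw
  ... | inj₁ (refl , _) with does (i ≟ j)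
  ...   | true  = ≤-trans (δ≤1 a b) (s≤s z≤n)
  ...   | false = s≤s (+-mono-≤ (≤-trans (δ≤1 a j) (s≤s z≤n)) ≤-refl)
  dist-step {⟨ i , a ⟩} ⟨ j , b ⟩ uw | inj₂ (i≢a , refl , refl) with j ≟ a
  ... | yes refl = ≤-reflexive (begin
    dist ⟨ i , a ⟩ ⟨ a , b ⟩  ≡⟨ dist-≢ a b i≢a ⟩
    suc (δ a a + δ b i)       ≡⟨ cong (λ m → suc (m + δ b i)) (δ-refl a) ⟩
    suc (δ b i)               ≡⟨ cong suc (δ-sym b i) ⟩
    suc (δ i b)               ≡˘⟨ cong suc (dist-≡ a i b) ⟩
    suc (dist ⟨ a , i ⟩ ⟨ a , b ⟩) ∎)
    where open ≡-Reasoning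
  ... | no  j≢a with j ≟ i
  ...   | yes refl = ≤-trans (≤-reflexive (dist-≡ i a b)) (≤-trans (δ≤1 a b) (s≤s z≤n))
  ...   | no  j≢i  = ≤-trans (dist≤3 ⟨ i , a ⟩ ⟨ j , b ⟩) (s≤s (dist-≢-≥2 (j≢a ∘ sym) (j≢i ∘ sym)))

  dist≤len : ∀ {u v} (P : Walk Adj u v) → dist u v ≤ len Adj P
  dist≤len = len-lowerBound dist dist-diag (λ {u} {w} → dist-step {u} {w})

  private
    tooShort : ∀ {u v k} (P : Walk Adj u v) → k < dist u v → ¬ len Adj P ≤ k
    tooShort P k<dist len≤k = <⇒≱ k<dist (≤-trans (dist≤len P) len≤k)

  bridge∈shortWalk : ∀ {i j b} → i ≢ j → (P : Walk Adj ⟨ i , j ⟩ ⟨ j , b ⟩) → len Adj P ≤ 2 → ⟨ j , i ⟩ ∈ᵂ P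
  bridge∈shortWalk i≢j here _ = contradiction refl i≢j
  bridge∈shortWalk i≢j (step {v = ⟨ _ , _ ⟩} uv P) (s≤s len≤1) with adj-cases uv
  ... | inj₁ (refl , j≢e)    = contradiction len≤1 (tooShort P (dist-≢-≥2 i≢j (j≢e ∘ sym)))
  ... | inj₂ (_ , refl , refl) = inj₂ (start∈W P)

  corner∈shortWalk : ∀ {k i j} → k ≢ j → i ≢ j → (P : Walk Adj ⟨ k , i ⟩ ⟨ j , k ⟩) → len Adj P ≤ 2 →
                     ⟨ k , j ⟩ ∈ᵂ P
  corner∈shortWalk k≢j i≢j here _ = contradiction refl k≢j
  corner∈shortWalk {j = j} k≢j i≢j (step {v = ⟨ _ , e ⟩} uv P) (s≤s len≤1) with adj-cases uv
  ... | inj₂ (_ , refl , refl) = contradiction len≤1 (tooShort P (dist-≢-≥2 i≢j k≢j))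
  ... | inj₁ (refl , _) with e ≟ j
  ...   | yes refl = inj₂ (start∈W P)
  ...   | no  e≢j  = contradiction len≤1 (tooShort P (dist-≢-≥2 k≢j e≢j))

  geodesic-interior : ∀ {i a j b} → i ≢ j → a ≢ j → b ≢ i → (P : Walk Adj ⟨ i , a ⟩ ⟨ j , b ⟩) → len Adj P ≤ 3 →
    (⟨ i , j ⟩ ∈ᵂ P × ⟨ j , i ⟩ ∈ᵂ P) ⊎ (a ≡ b × a ≢ i × ⟨ a , i ⟩ ∈ᵂ P × ⟨ a , j ⟩ ∈ᵂ P)
  geodesic-interior i≢j a≢j b≢i here _ = contradiction refl i≢j
  geodesic-interior {j = j} {b} i≢j a≢j b≢i (step {v = ⟨ _ , e ⟩} uv P) (s≤s len≤2) with adj-cases uv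
  ... | inj₁ (refl , _) with e ≟ j
  ...   | yes refl = inj₁ (inj₂ (start∈W P) , inj₂ (bridge∈shortWalk i≢j P len≤2))
  ...   | no  e≢j  = contradiction len≤2 (tooShort P (dist-≢-≥3 i≢j e≢j b≢i))
  geodesic-interior {i} {a} {j} {b} i≢j a≢j b≢i (step uv P) (s≤s len≤2) | inj₂ (i≢a , refl , refl) with b ≟ a
  ... | yes refl = inj₂ (refl , i≢a ∘ sym , inj₂ (start∈W P) , inj₂ (corner∈shortWalk a≢j i≢j P len≤2))
  ... | no  b≢a  = contradiction len≤2 (tooShort P (dist-≢-≥3 a≢j i≢j b≢a))

  bridgeWalk : ∀ {i j b} → i ≢ j → b ≢ i → Walk Adj ⟨ i , j ⟩ ⟨ j , b ⟩
  bridgeWalk {i} {j} {b} i≢j b≢i = step {v = ⟨ j , i ⟩} (adj-bridge i≢j) (step {v = ⟨ j , b ⟩} (adj-inner (b≢i ∘ sym)) here)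

  crossingWalk : ∀ {i a j b} → i ≢ j → a ≢ j → b ≢ i → Walk Adj ⟨ i , a ⟩ ⟨ j , b ⟩
  crossingWalk {i} {j = j} i≢j a≢j b≢i = step {v = ⟨ i , j ⟩} (adj-inner a≢j) (bridgeWalk i≢j b≢i)

  ≢-fst : ∀ {i a j b : Fin p} → i ≢ j → _≢_ {A = Vertex} ⟨ i , a ⟩ ⟨ j , b ⟩
  ≢-fst i≢j refl = i≢j refl

  ≢-snd : ∀ {i a j b : Fin p} → a ≢ b → _≢_ {A = Vertex} ⟨ i , a ⟩ ⟨ j , b ⟩
  ≢-snd a≢b refl = a≢b refl

  row : (Vertex → Bool) → Fin p → Subset p
  row X i = tabulate (λ a → X ⟨ i , a ⟩)

  module _ {X : Vertex → Bool} (mv : MVS p 2 X) where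

    private
      avoided : ∀ {u v x} (P : Walk Adj u v) → (∀ y → y ∈ᵂ P → X y ≡ true → y ≡ u ⊎ y ≡ v) →
                x ∈ᵂ P → x ≢ u → x ≢ v → X x ≢ true
      avoided P blocks x∈P x≢u x≢v Xx with blocks _ x∈P Xx
      ... | inj₁ x≡u = x≢u x≡u
      ... | inj₂ x≡v = x≢v x≡v

      bridge : ∀ {i j b} → i ≢ j → b ≢ i → j ∈ row X i → b ∈ row X j → i ∉ row X j
      bridge i≢j b≢i j∈ b∈ i∈ with mv _ _ (∈-tabulate⁻ j∈) (∈-tabulate⁻ b∈)
      ... | P , shortest , blocks =
        avoided P blocks (bridge∈shortWalk i≢j P (shortest (bridgeWalk i≢j b≢i)))
                (≢-fst (i≢j ∘ sym)) (≢-snd (b≢i ∘ sym)) (∈-tabulate⁻ i∈)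

      cross : ∀ {i a j b} → i ≢ j → a ≢ j → b ≢ i → a ∈ row X i → b ∈ row X j →
              (j ∉ row X i × i ∉ row X j) ⊎ (a ≡ b × i ∉ row X a × j ∉ row X a)
      cross i≢j a≢j b≢i a∈ b∈ with mv _ _ (∈-tabulate⁻ a∈) (∈-tabulate⁻ b∈)
      ... | P , shortest , blocks with geodesic-interior i≢j a≢j b≢i P (shortest (crossingWalk i≢j a≢j b≢i))
      ...   | inj₁ (ij∈P , ji∈P) =
        inj₁ ( (λ j∈ → avoided P blocks ij∈P (≢-snd (a≢j ∘ sym)) (≢-fst i≢j) (∈-tabulate⁻ j∈))
             , (λ i∈ → avoided P blocks ji∈P (≢-fst (i≢j ∘ sym)) (≢-snd (b≢i ∘ sym)) (∈-tabulate⁻ i∈)))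
      ...   | inj₂ (refl , a≢i , ai∈P , aj∈P) =
        inj₂ ( refl
             , (λ i∈ → avoided P blocks ai∈P (≢-fst a≢i) (≢-fst a≢j) (∈-tabulate⁻ i∈))
             , (λ j∈ → avoided P blocks aj∈P (≢-fst a≢i) (≢-fst a≢j) (∈-tabulate⁻ j∈)))

    rowConstraints : VisibilityConstraints (row X)
    rowConstraints = record { bridge = bridge ; cross = cross }

  card≡∑∣row∣ : ∀ X → card p 2 X ≡ ∑[ i < p ] ∣ row X i ∣
  card≡∑∣row∣ X = trans (card-∷ p 1 X) (sum-cong-≗ λ i → begin
    card p 1 (λ w → X (i ∷ w))                          ≡⟨ card-∷ p 0 (λ w → X (i ∷ w)) ⟩
    ∑[ a < p ] card p 0 (λ w → X (i ∷ a ∷ w))           ≡⟨ sum-cong-≗ (λ a → card-[] p (λ w → X (i ∷ a ∷ w))) ⟩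
    ∑[ a < p ] (if X ⟨ i , a ⟩ then 1 else 0)           ≡˘⟨ ∣tabulate∣≡∑ p (λ a → X ⟨ i , a ⟩) ⟩
    ∣ row X i ∣                                         ∎)
    where open ≡-Reasoning

  idealSet : Subset p → Vertex → Bool
  idealSet S ⟨ i , a ⟩ = lookup (idealRow S i) a

  module _ {X : Vertex → Bool} (mv : MVS p 2 X) where

    private
      Z : Subset p
      Z = occupied (row X)

    card≤∣occupied∣*[1+∣∁occupied∣] : card p 2 X ≤ ∣ Z ∣ * suc ∣ ∁ Z ∣
    card≤∣occupied∣*[1+∣∁occupied∣] =
      ≤-trans (≤-reflexive (card≡∑∣row∣ X)) (∑∣row∣≤∣occupied∣*[1+∣∁occupied∣] (rowConstraints mv))

    card≡⇒≗idealSet : card p 2 X ≡ ∣ Z ∣ * suc ∣ ∁ Z ∣ → 1 ≤ ∣ ∁ Z ∣ → ∀ w → X w ≡ idealSet Z w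
    card≡⇒≗idealSet eq ∣∁Z∣≥1 ⟨ i , a ⟩ = begin
      X ⟨ i , a ⟩                   ≡˘⟨ lookup∘tabulate (λ a → X ⟨ i , a ⟩) a ⟩
      lookup (row X i) a            ≡⟨ cong (λ r → lookup r a) (rows≡ i) ⟩
      lookup (idealRow Z i) a       ∎
      where
      open ≡-Reasoning
      rows≡ : ∀ i → row X i ≡ idealRow Z i
      rows≡ = ∑∣row∣≡⇒row≡idealRow (rowConstraints mv) (trans (sym (card≡∑∣row∣ X)) eq) ∣∁Z∣≥1

  card-idealSet : ∀ S → card p 2 (idealSet S) ≡ ∣ S ∣ * suc ∣ ∁ S ∣
  card-idealSet S = begin
    card p 2 (idealSet S)                 ≡⟨ card≡∑∣row∣ (idealSet S) ⟩
    ∑[ i < p ] ∣ row (idealSet S) i ∣     ≡⟨ sum-cong-≗ (λ i → cong ∣_∣ (tabulate∘lookup (idealRow S i))) ⟩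
    ∑[ i < p ] ∣ idealRow S i ∣           ≡⟨ ∑∣idealRow∣ S ⟩
    ∣ S ∣ * suc ∣ ∁ S ∣                   ∎
    where open ≡-Reasoning

  ∈-idealSet : ∀ {S i a} → idealSet S ⟨ i , a ⟩ ≡ true → a ∈ idealRow S i
  ∈-idealSet {S} {i} {a} = lookup⇒[]= a (idealRow S i)

  idealSet-mvs : ∀ S → MVS p 2 (idealSet S)
  idealSet-mvs S ⟨ i , a ⟩ ⟨ j , b ⟩ u∈ v∈ with i ≟ j
  ... | yes refl with a ≟ b
  ...   | yes refl = here , (λ _ → z≤n) , (λ _ x≡u _ → inj₁ x≡u)
  ...   | no  a≢b  = step {v = ⟨ i , b ⟩} (adj-inner a≢b) here
                   , (λ Q → ≤-trans (≤-reflexive (sym (trans (dist-≡ i a b) (δ-≢ a≢b)))) (dist≤len Q))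
                   , (λ _ x∈ _ → x∈)
  idealSet-mvs S ⟨ i , a ⟩ ⟨ j , b ⟩ u∈ v∈ | no i≢j =
    crossingWalk i≢j a≢j b≢i , (λ Q → ≤-trans (dist-≢-≥3 i≢j a≢j b≢i) (dist≤len Q)) , onlyEnds
    where
    i∈S : i ∈ S
    i∈S = proj₁ (∈-idealRow⁻ (∈-idealSet {S} u∈))
    j∈S : j ∈ S
    j∈S = proj₁ (∈-idealRow⁻ (∈-idealSet {S} v∈))
    a≢j : a ≢ j
    a≢j refl = ∉-idealRow j∈S (i≢j ∘ sym) (∈-idealSet {S} u∈)
    b≢i : b ≢ i
    b≢i refl = ∉-idealRow i∈S i≢j (∈-idealSet {S} v∈)
    onlyEnds : ∀ x → x ∈ᵂ crossingWalk i≢j a≢j b≢i → idealSet S x ≡ true → x ≡ ⟨ i , a ⟩ ⊎ x ≡ ⟨ j , b ⟩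
    onlyEnds x (inj₁ x≡u)                  _  = inj₁ x≡u
    onlyEnds x (inj₂ (inj₁ refl))          x∈ = contradiction (∈-idealSet {S} x∈) (∉-idealRow j∈S (i≢j ∘ sym))
    onlyEnds x (inj₂ (inj₂ (inj₁ refl)))   x∈ = contradiction (∈-idealSet {S} x∈) (∉-idealRow i∈S i≢j)
    onlyEnds x (inj₂ (inj₂ (inj₂ x≡v)))    _  = inj₂ x≡v

  idealSet-diagonal : ∀ S i → idealSet S ⟨ i , i ⟩ ≡ lookup S i
  idealSet-diagonal S i with lookup S i
  ... | true  = []=⇒lookup (x∈p∪q⁺ (inj₁ (x∈⁅x⁆ i)))
  ... | false = lookup-replicate i outside

  idealSet-distinct : ∀ {S T} → S ≢ T → ∃ λ w → idealSet S w ≢ idealSet T w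
  idealSet-distinct {S} {T} S≢T with ¬∀⟶∃¬ p _ (λ i → lookup S i Bool.≟ lookup T i) (S≢T ∘ lookup-ext)
    where
    lookup-ext : (∀ i → lookup S i ≡ lookup T i) → S ≡ T
    lookup-ext eq = trans (sym (tabulate∘lookup S)) (trans (tabulate-cong eq) (tabulate∘lookup T))
  ... | i , Si≢Ti = ⟨ i , i ⟩ , λ eq → Si≢Ti (trans (sym (idealSet-diagonal S i)) (trans eq (idealSet-diagonal T i)))

  module _ {m} (bound : ∀ (S : Subset p) → ∣ S ∣ * suc ∣ ∁ S ∣ ≤ m) where

    mvs-card≤ : ∀ X → MVS p 2 X → card p 2 X ≤ m
    mvs-card≤ X mv = ≤-trans (card≤∣occupied∣*[1+∣∁occupied∣] mv) (bound (occupied (row X)))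

    isMu : ∀ S → ∣ S ∣ * suc ∣ ∁ S ∣ ≡ m → IsMu p 2 m
    isMu S eq = (idealSet S , idealSet-mvs S , trans (card-idealSet S) eq) , mvs-card≤

    numMVSOfSize : (Ls : List (Subset p)) → Unique Ls →
      (∀ {S} → S L.∈ Ls → ∣ S ∣ * suc ∣ ∁ S ∣ ≡ m) →
      (∀ S → ∣ S ∣ * suc ∣ ∁ S ∣ ≡ m → S L.∈ Ls × 1 ≤ ∣ ∁ S ∣) →
      NumMVSOfSize p 2 m (length Ls)
    numMVSOfSize Ls unique sound complete =
      map idealSet Ls , length-map idealSet Ls ,
      All.map⁺ (All.tabulate λ {S} S∈ → idealSet-mvs S , trans (card-idealSet S) (sound S∈)) ,
      AllPairs.map⁺ (AllPairs.map idealSet-distinct unique) ,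
      covered
      where
      covered : ∀ X → MVS p 2 X → card p 2 X ≡ m → Any (λ Y → ∀ w → X w ≡ Y w) (map idealSet Ls)
      covered X mv card≡m = Any.map⁺ (Any.map (λ { refl → X≗idealSet }) Z∈Ls)
        where
        Z : Subset p
        Z = occupied (row X)
        value≡m : ∣ Z ∣ * suc ∣ ∁ Z ∣ ≡ m
        value≡m = ≤-antisym (bound Z) (subst (_≤ _) card≡m (card≤∣occupied∣*[1+∣∁occupied∣] mv))
        Z∈Ls : Z L.∈ Ls
        Z∈Ls = proj₁ (complete Z value≡m)
        X≗idealSet : ∀ w → X w ≡ idealSet Z w
        X≗idealSet = card≡⇒≗idealSet mv (trans card≡m (sym value≡m)) (proj₂ (complete Z value≡m))

-- Odd and even p

module OddOrder (q : ℕ) (q≥1 : 1 ≤ q) where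

  open SierpińskiSquare (suc (q + q))

  private
    p : ℕ
    p = suc (q + q)

    ∣S∣+[1+∣∁S∣]≡2[1+q] : ∀ (S : Subset p) → ∣ S ∣ + suc ∣ ∁ S ∣ ≡ suc q + suc q
    ∣S∣+[1+∣∁S∣]≡2[1+q] S = trans (+-suc _ _) (cong suc (trans (∣p∣+∣∁p∣≡n S) (sym (+-suc q q))))

    bound : ∀ (S : Subset p) → ∣ S ∣ * suc ∣ ∁ S ∣ ≤ suc q * suc q
    bound S = m+n≡2k⇒m*n≤k*k ∣ S ∣ (suc ∣ ∁ S ∣) (suc q) (∣S∣+[1+∣∁S∣]≡2[1+q] S)

    value-of-size : ∀ (S : Subset p) → ∣ S ∣ ≡ suc q → ∣ S ∣ * suc ∣ ∁ S ∣ ≡ suc q * suc q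
    value-of-size S ∣S∣≡ = cong₂ (λ x y → x * suc y) ∣S∣≡ (∣p∣≡k⇒∣∁p∣≡l S ∣S∣≡)

    maximizer : ∀ (S : Subset p) → ∣ S ∣ * suc ∣ ∁ S ∣ ≡ suc q * suc q → S L.∈ subsetsOfSize p (suc q) × 1 ≤ ∣ ∁ S ∣
    maximizer S eq = subst (λ k → S L.∈ subsetsOfSize p k) ∣S∣≡ (∈-subsetsOfSize⁺ S)
                   , subst (1 ≤_) (sym (∣p∣≡k⇒∣∁p∣≡l S ∣S∣≡)) q≥1
      where
      ∣S∣≡ = m+n≡2k⇒m*n≡k*k⇒m≡k ∣ S ∣ (suc ∣ ∁ S ∣) (suc q) (∣S∣+[1+∣∁S∣]≡2[1+q] S) eq

  μ : IsMu p 2 (suc q * suc q)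
  μ = let S , ∣S∣≡ = subsetOfSize {p} {suc q} (s≤s (m≤m+n q q)) in isMu bound S (value-of-size S ∣S∣≡)

  numberOfMaximumSets : NumMVSOfSize p 2 (suc q * suc q) (p C suc q)
  numberOfMaximumSets = subst (NumMVSOfSize p 2 (suc q * suc q)) (length-subsetsOfSize p (suc q))
    (numMVSOfSize bound (subsetsOfSize p (suc q)) (subsetsOfSize-unique p (suc q))
      (λ {S} S∈ → value-of-size S (∈-subsetsOfSize⁻ p (suc q) S∈)) maximizer)

module EvenOrder (q : ℕ) (q≥2 : 2 ≤ q) where

  open SierpińskiSquare (q + q)

  private
    p : ℕ
    p = q + q

    ∣S∣+[1+∣∁S∣]≡1+2q : ∀ (S : Subset p) → ∣ S ∣ + suc ∣ ∁ S ∣ ≡ suc (q + q)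
    ∣S∣+[1+∣∁S∣]≡1+2q S = trans (+-suc _ _) (cong suc (∣p∣+∣∁p∣≡n S))

    bound : ∀ (S : Subset p) → ∣ S ∣ * suc ∣ ∁ S ∣ ≤ q * suc q
    bound S = m+n≡1+2k⇒m*n≤k*[1+k] ∣ S ∣ (suc ∣ ∁ S ∣) q (∣S∣+[1+∣∁S∣]≡1+2q S)

    1+∣∁S∣≡q : ∀ (S : Subset p) → ∣ S ∣ ≡ suc q → suc ∣ ∁ S ∣ ≡ q
    1+∣∁S∣≡q S ∣S∣≡ = +-cancelˡ-≡ q _ _ (suc-injective (trans (cong (_+ suc ∣ ∁ S ∣) (sym ∣S∣≡)) (∣S∣+[1+∣∁S∣]≡1+2q S)))

    value-of-size : ∀ (S : Subset p) → ∣ S ∣ ≡ q ⊎ ∣ S ∣ ≡ suc q → ∣ S ∣ * suc ∣ ∁ S ∣ ≡ q * suc q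
    value-of-size S (inj₁ ∣S∣≡) = cong₂ (λ x y → x * suc y) ∣S∣≡ (∣p∣≡k⇒∣∁p∣≡l S ∣S∣≡)
    value-of-size S (inj₂ ∣S∣≡) = trans (cong₂ _*_ ∣S∣≡ (1+∣∁S∣≡q S ∣S∣≡)) (*-comm (suc q) q)

    maximizers : List (Subset p)
    maximizers = subsetsOfSize p q ++ subsetsOfSize p (suc q)

    ∈-maximizers⁻ : ∀ {S} → S L.∈ maximizers → ∣ S ∣ ≡ q ⊎ ∣ S ∣ ≡ suc q
    ∈-maximizers⁻ S∈ with ∈-++⁻ (subsetsOfSize p q) S∈
    ... | inj₁ S∈₀ = inj₁ (∈-subsetsOfSize⁻ p q S∈₀)
    ... | inj₂ S∈₁ = inj₂ (∈-subsetsOfSize⁻ p (suc q) S∈₁)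

    maximizers-unique : Unique maximizers
    maximizers-unique = Unique.++⁺ (subsetsOfSize-unique p q) (subsetsOfSize-unique p (suc q))
      λ (S∈₀ , S∈₁) → 1+n≢n (trans (sym (∈-subsetsOfSize⁻ p (suc q) S∈₁)) (∈-subsetsOfSize⁻ p q S∈₀))

    maximizer : ∀ (S : Subset p) → ∣ S ∣ * suc ∣ ∁ S ∣ ≡ q * suc q → S L.∈ maximizers × 1 ≤ ∣ ∁ S ∣
    maximizer S eq with m+n≡1+2k⇒m*n≡k*[1+k]⇒m≡k⊎m≡1+k ∣ S ∣ (suc ∣ ∁ S ∣) q (∣S∣+[1+∣∁S∣]≡1+2q S) eq
    ... | inj₁ ∣S∣≡ = ∈-++⁺ˡ (subst (λ k → S L.∈ subsetsOfSize p k) ∣S∣≡ (∈-subsetsOfSize⁺ S))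
                    , subst (1 ≤_) (sym (∣p∣≡k⇒∣∁p∣≡l S ∣S∣≡)) (≤-trans (s≤s z≤n) q≥2)
    ... | inj₂ ∣S∣≡ = ∈-++⁺ʳ (subsetsOfSize p q) (subst (λ k → S L.∈ subsetsOfSize p k) ∣S∣≡ (∈-subsetsOfSize⁺ S))
                    , s≤s⁻¹ (subst (2 ≤_) (sym (1+∣∁S∣≡q S ∣S∣≡)) q≥2)

    length-maximizers : length maximizers ≡ suc p C suc q
    length-maximizers = begin
      length maximizers                                               ≡⟨ length-++ (subsetsOfSize p q) ⟩
      length (subsetsOfSize p q) + length (subsetsOfSize p (suc q))   ≡⟨ cong₂ _+_ (length-subsetsOfSize p q) (length-subsetsOfSize p (suc q)) ⟩
      p C q + p C suc q                                               ≡⟨ nCk+nC[k+1]≡[n+1]C[k+1] p q ⟩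
      suc p C suc q                                                   ∎
      where open ≡-Reasoning

  μ : IsMu p 2 (q * suc q)
  μ = let S , ∣S∣≡ = subsetOfSize {p} {q} (m≤m+n q q) in isMu bound S (value-of-size S (inj₁ ∣S∣≡))

  numberOfMaximumSets : NumMVSOfSize p 2 (q * suc q) (suc p C suc q)
  numberOfMaximumSets = subst (NumMVSOfSize p 2 (q * suc q)) length-maximizers
    (numMVSOfSize bound maximizers maximizers-unique (λ {S} S∈ → value-of-size S (∈-maximizers⁻ S∈)) maximizer)

m*2≡m+m : ∀ m → m * 2 ≡ m + m
m*2≡m+m = solve-∀

odd⇒≡1+2[/2] : ∀ p → p % 2 ≡ 1 → p ≡ suc (p / 2 + p / 2)
odd⇒≡1+2[/2] p p%2≡1 = trans (m≡m%n+[m/n]*n p 2) (cong₂ _+_ p%2≡1 (m*2≡m+m (p / 2)))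

even⇒≡2[/2] : ∀ p → p % 2 ≡ 0 → p ≡ p / 2 + p / 2
even⇒≡2[/2] p p%2≡0 = trans (m≡m%n+[m/n]*n p 2) (cong₂ _+_ p%2≡0 (m*2≡m+m (p / 2)))

[1+2q+1]²/4≡[1+q]² : ∀ q → ((suc (q + q) + 1) * (suc (q + q) + 1)) / 4 ≡ suc q * suc q
[1+2q+1]²/4≡[1+q]² q = trans (cong (_/ 4) (identity q)) (m*n/n≡m (suc q * suc q) 4)
  where
  identity : ∀ q → (suc (q + q) + 1) * (suc (q + q) + 1) ≡ (suc q * suc q) * 4
  identity = solve-∀

[1+2q+1]/2≡1+q : ∀ q → (suc (q + q) + 1) / 2 ≡ suc q
[1+2q+1]/2≡1+q q = trans (cong (_/ 2) (identity q)) (m*n/n≡m (suc q) 2)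
  where
  identity : ∀ q → suc (q + q) + 1 ≡ suc q * 2
  identity = solve-∀

2q[2q+2]/4≡q[1+q] : ∀ q → ((q + q) * ((q + q) + 2)) / 4 ≡ q * suc q
2q[2q+2]/4≡q[1+q] q = trans (cong (_/ 4) (identity q)) (m*n/n≡m (q * suc q) 4)
  where
  identity : ∀ q → (q + q) * ((q + q) + 2) ≡ (q * suc q) * 4
  identity = solve-∀

[2q+2]/2≡1+q : ∀ q → ((q + q) + 2) / 2 ≡ suc q
[2q+2]/2≡1+q q = trans (cong (_/ 2) (identity q)) (m*n/n≡m (suc q) 2)
  where
  identity : ∀ q → (q + q) + 2 ≡ suc q * 2
  identity = solve-∀

oddCase : ∀ p q → p ≡ suc (q + q) → 1 ≤ q →
  IsMu p 2 (((p + 1) * (p + 1)) / 4) × NumMVSOfSize p 2 (((p + 1) * (p + 1)) / 4) (p C ((p + 1) / 2))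
oddCase _ q refl q≥1 rewrite [1+2q+1]²/4≡[1+q]² q | [1+2q+1]/2≡1+q q =
  OddOrder.μ q q≥1 , OddOrder.numberOfMaximumSets q q≥1

evenCase : ∀ p q → p ≡ q + q → 2 ≤ q →
  IsMu p 2 ((p * (p + 2)) / 4) × NumMVSOfSize p 2 ((p * (p + 2)) / 4) ((p + 1) C ((p + 2) / 2))
evenCase _ q refl q≥2 rewrite 2q[2q+2]/4≡q[1+q] q | [2q+2]/2≡1+q q | +-comm (q + q) 1 =
  EvenOrder.μ q q≥2 , EvenOrder.numberOfMaximumSets q q≥2

3≤1+2q⇒1≤q : ∀ q → 3 ≤ suc (q + q) → 1 ≤ q
3≤1+2q⇒1≤q zero    (s≤s ())
3≤1+2q⇒1≤q (suc q) _ = s≤s z≤n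

3≤2q⇒2≤q : ∀ q → 3 ≤ q + q → 2 ≤ q
3≤2q⇒2≤q zero          ()
3≤2q⇒2≤q (suc zero)    (s≤s (s≤s ()))
3≤2q⇒2≤q (suc (suc q)) _ = s≤s (s≤s z≤n)

theorem3p1 : ∀ (p : ℕ) → 3 ≤ p →
    (p % 2 ≡ 1 →
       IsMu p 2 (((p + 1) * (p + 1)) / 4) ×
       NumMVSOfSize p 2 (((p + 1) * (p + 1)) / 4) (p C ((p + 1) / 2))) ×
    (p % 2 ≡ 0 →
       IsMu p 2 ((p * (p + 2)) / 4) ×
       NumMVSOfSize p 2 ((p * (p + 2)) / 4) ((p + 1) C ((p + 2) / 2)))
theorem3p1 p 3≤p =
  (λ p%2≡1 → let p≡ = odd⇒≡1+2[/2] p p%2≡1 in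
    oddCase p (p / 2) p≡ (3≤1+2q⇒1≤q (p / 2) (subst (3 ≤_) p≡ 3≤p))) ,
  (λ p%2≡0 → let p≡ = even⇒≡2[/2] p p%2≡0 in
    evenCase p (p / 2) p≡ (3≤2q⇒2≤q (p / 2) (subst (3 ≤_) p≡ 3≤p)))
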